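{- For any $\ell\ge1$ and any $\ell$-tuples of non-negative integers $\vec\alpha,\vec\beta$, $$\sum_{m=0}^\infty M^\ell_m(\vec\alpha,\vec\beta,t)=\frac{M^\ell_0(\vec\alpha,\vec\beta,t)}{1-t\,M^\ell_0(\vec\beta,\vec\beta,t)}=M^\ell_0(\vec\alpha,\vec\beta,t)\left(1+t\,M^\ell_0(\vec\beta,\vec\beta,t)+t^2M^\ell_0(\vec\beta,\vec\beta,t)^2+\cdots\right).$$
   Context: An order-$\ell$ Motzkin path of length $n$ and height $m$ is an integer lattice path from $(0,0)$ to $(n,m)$ using steps $U=(1,1)$ and $D_i=(1,-i)$ for $0\le i\le \ell$, never going below $y=0$. For $\ell$-tuples of non-negative integers $\vec\alpha=(\alpha_0,\dots,\alpha_{\ell-1}),\vec\beta=(\beta_0,\dots,\beta_{\ell-1})$, an $(\vec\alpha,\vec\beta)$-colored Motzkin path is such a path in which, for each $0\le i\le \ell-1$, each $D_i$ step whose right endpoint is at height $0$ is labeled by one of $\alpha_i$ colors and each $D_i$ step whose right endpoint is at height $>0$ is labeled by one of $\beta_i$ colors; $U$ and $D_\ell$ steps are unlabeled. $M^\ell_{n,m}(\vec\alpha,\vec\beta)$ is the number of such colored paths of length $n$ and height $m$, and $M^\ell_m(\vec\alpha,\vec\beta,t)=\sum_{n\ge0}M^\ell_{n,m}(\vec\alpha,\vec\beta)t^n$. -}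

module Defs where

open import Data.Nat using (ℕ; zero; suc; _+_; _*_; _∸_)
open import Data.Fin using (Fin; toℕ)
open import Data.Fin.Base using () renaming (zero to fzero; suc to fsuc)

ΣFin : (k : ℕ) → (Fin k → ℕ) → ℕ
ΣFin zero    f = 0
ΣFin (suc k) f = f fzero + ΣFin k (λ i → f (fsuc i))

sumUpTo : ℕ → (ℕ → ℕ) → ℕ
sumUpTo zero    f = f 0
sumUpTo (suc N) f = sumUpTo N f + f (suc N)

-- Number of (α,β)-colored order-ℓ Motzkin paths of length n from (0,0)
-- ending at height h, i.e. M^ℓ_{n,h}(α,β).  Defined by decomposing a
-- path according to its last step:
--   * U   (from height h-1, only if h ≥ 1), unlabeled;
--   * D_i for i < ℓ (from height h+i), with α_i colors if h = 0 and
--     β_i colors if h > 0 (h is the height of the right endpoint);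
--   * D_ℓ (from height h+ℓ), unlabeled.
-- Paths never go below 0 because every intermediate height is a ℕ.
Motzkin : (ℓ : ℕ) → (α β : Fin ℓ → ℕ) → (n h : ℕ) → ℕ
Motzkin ℓ α β zero    zero    = 1
Motzkin ℓ α β zero    (suc h) = 0
Motzkin ℓ α β (suc n) zero    =
  ΣFin ℓ (λ i → α i * Motzkin ℓ α β n (toℕ i)) + Motzkin ℓ α β n ℓ
Motzkin ℓ α β (suc n) (suc h) =
  Motzkin ℓ α β n h
  + ΣFin ℓ (λ i → β i * Motzkin ℓ α β n (suc h + toℕ i))
  + Motzkin ℓ α β n (suc h + ℓ)

Series : Set
Series = ℕ → ℕ

Mgf : (ℓ : ℕ) → (α β : Fin ℓ → ℕ) → ℕ → Series
Mgf ℓ α β m n = Motzkin ℓ α β n m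

_⋆_ : Series → Series → Series
(f ⋆ g) n = sumUpTo n (λ k → f k * g (n ∸ k))

_⊕_ : Series → Series → Series
(f ⊕ g) n = f n + g n

tMul : Series → Series
tMul f zero    = 0
tMul f (suc n) = f n

one : Series
one zero    = 1
one (suc n) = 0

pow : Series → ℕ → Series
pow f zero    = one
pow f (suc k) = f ⋆ pow f k

sumSeries : ℕ → (ℕ → Series) → Series
sumSeries K F n = sumUpTo K (λ k → F k n)

-- A path ending at height m + 1 + h splits at its last visit to height m into an
-- (α,β)-path to height m, an up step, and a path staying strictly above height m.
-- Every step of the latter ends at positive height, so carries a β-colour: shifted
-- down by m + 1 it is a (β,β)-path to height h.  Hence
--   M_{m+1+h}(α,β) = t M_h(β,β) M_m(α,β).
-- For h = 0 this is M_{m+1}(α,β) = t M_0(β,β) M_m(α,β), which summed over m gives (1).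
-- With α = β the case h = 0 gives t M_h(β,β) = (t M_0(β,β))^{h+1} by induction on h,
-- and then the case m = 0 gives M_p(α,β) = M_0(α,β) (t M_0(β,β))^p, which summed over
-- p gives (2).  A path of length n has height at most n, so only finitely many terms
-- contribute to each coefficient.
module Submission where

open import Defs
open import Data.Nat using (ℕ; _≤_)
open import Data.Fin using (Fin)
open import Data.Product using (_×_)
open import Relation.Binary.PropositionalEquality using (_≡_)

open import Data.Fin as Fin using (toℕ; opposite)
open import Data.Fin.Permutation using (reverse)
open import Data.Fin.Properties using (toℕ≤pred[n]; opposite-prop)
open import Data.Nat using (zero; suc; _+_; _*_; _∸_; _<_; _≤′_; ≤′-refl; ≤′-step; s≤s)
open import Data.Nat.Properties
open import Algebra.Properties.Semiring.Sum +-*-semiring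
  using (sum-syntax; sum⁺-syntax; sum-cong-≗; sum-replicate-zero; ∑-distrib-+; ∑-comm; ∑-permute;
         *-distribˡ-sum; *-distribʳ-sum)
open import Data.Product using (_,_)
open import Function using (_∘_)
open import Relation.Binary.PropositionalEquality
  using (refl; sym; trans; cong; cong₂; _≗_; module ≡-Reasoning)
open ≡-Reasoning

ΣFin≡∑ : ∀ k (f : Fin k → ℕ) → ΣFin k f ≡ ∑[ i < k ] f i
ΣFin≡∑ zero    f = refl
ΣFin≡∑ (suc k) f = cong (f Fin.zero +_) (ΣFin≡∑ k (f ∘ Fin.suc))

ΣFin-cong : ∀ k {f g : Fin k → ℕ} → f ≗ g → ΣFin k f ≡ ΣFin k g
ΣFin-cong k {f} {g} f≗g = trans (ΣFin≡∑ k f) (trans (sum-cong-≗ f≗g) (sym (ΣFin≡∑ k g)))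

sumUpTo-peel : ∀ N (f : ℕ → ℕ) → sumUpTo (suc N) f ≡ f 0 + sumUpTo N (f ∘ suc)
sumUpTo-peel zero    f = refl
sumUpTo-peel (suc N) f = trans (cong (_+ f (suc (suc N))) (sumUpTo-peel N f)) (+-assoc (f 0) _ _)

sumUpTo≡∑ : ∀ N (f : ℕ → ℕ) → sumUpTo N f ≡ ∑[ i ≤ N ] f (toℕ i)
sumUpTo≡∑ zero    f = sym (+-identityʳ (f 0))
sumUpTo≡∑ (suc N) f = trans (sumUpTo-peel N f) (cong (f 0 +_) (sumUpTo≡∑ N (f ∘ suc)))

sumUpTo-cong : ∀ N {f g : ℕ → ℕ} → f ≗ g → sumUpTo N f ≡ sumUpTo N g
sumUpTo-cong zero    f≗g = f≗g 0
sumUpTo-cong (suc N) f≗g = cong₂ _+_ (sumUpTo-cong N f≗g) (f≗g (suc N))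

sumUpTo-vanishing-tail : ∀ {N N'} (f : ℕ → ℕ) → (∀ p → N < p → f p ≡ 0) → N ≤ N' →
                         sumUpTo N' f ≡ sumUpTo N f
sumUpTo-vanishing-tail {N} f tail≡0 N≤N' = go (≤⇒≤′ N≤N')
  where
    go : ∀ {N'} → N ≤′ N' → sumUpTo N' f ≡ sumUpTo N f
    go ≤′-refl              = refl
    go (≤′-step {N'} N≤′N') =
      trans (cong₂ _+_ (go N≤′N') (tail≡0 (suc N') (s≤s (≤′⇒≤ N≤′N')))) (+-identityʳ _)

⋆-comm : ∀ (f g : Series) → f ⋆ g ≗ g ⋆ f
⋆-comm f g n = begin
  (f ⋆ g) n
    ≡⟨ sumUpTo≡∑ n _ ⟩
  ∑[ k ≤ n ] (f (toℕ k) * g (n ∸ toℕ k))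
    ≡⟨ ∑-permute (λ k → f (toℕ k) * g (n ∸ toℕ k)) reverse ⟩
  ∑[ k ≤ n ] (f (toℕ (opposite k)) * g (n ∸ toℕ (opposite k)))
    ≡⟨ sum-cong-≗ swap ⟩
  ∑[ k ≤ n ] (g (toℕ k) * f (n ∸ toℕ k))
    ≡⟨ sumUpTo≡∑ n _ ⟨
  (g ⋆ f) n
    ∎
  where
    swap : ∀ k → f (toℕ (opposite k)) * g (n ∸ toℕ (opposite k)) ≡ g (toℕ k) * f (n ∸ toℕ k)
    swap k = begin
      f (toℕ (opposite k)) * g (n ∸ toℕ (opposite k))
        ≡⟨ cong (λ j → f j * g (n ∸ j)) (opposite-prop k) ⟩
      f (n ∸ toℕ k) * g (n ∸ (n ∸ toℕ k))
        ≡⟨ cong (λ j → f (n ∸ toℕ k) * g j) (m∸[m∸n]≡n (toℕ≤pred[n] k)) ⟩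
      f (n ∸ toℕ k) * g (toℕ k)
        ≡⟨ *-comm (f (n ∸ toℕ k)) (g (toℕ k)) ⟩
      g (toℕ k) * f (n ∸ toℕ k)
        ∎

⋆-identityˡ : ∀ (f : Series) → one ⋆ f ≗ f
⋆-identityˡ f n = begin
  (one ⋆ f) n             ≡⟨ sumUpTo≡∑ n _ ⟩
  f n + 0 + ∑[ k < n ] 0  ≡⟨ cong₂ _+_ (+-identityʳ (f n)) (sum-replicate-zero n) ⟩
  f n + 0                 ≡⟨ +-identityʳ (f n) ⟩
  f n                     ∎

⋆-identityʳ : ∀ (f : Series) → f ⋆ one ≗ f
⋆-identityʳ f n = trans (⋆-comm f one n) (⋆-identityˡ f n)

⋆-congˡ : ∀ {f f' : Series} (g : Series) → f ≗ f' → f ⋆ g ≗ f' ⋆ g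
⋆-congˡ g f≗f' n = sumUpTo-cong n (λ k → cong (_* g (n ∸ k)) (f≗f' k))

⋆-congʳ-≤ : ∀ (f : Series) {g g' : Series} n → (∀ k → k ≤ n → g k ≡ g' k) → (f ⋆ g) n ≡ (f ⋆ g') n
⋆-congʳ-≤ f n g≡g' = sumUpTo-cong n (λ k → cong (f k *_) (g≡g' (n ∸ k) (m∸n≤m n k)))

tMul-⋆ : ∀ (f g : Series) n → (tMul f ⋆ g) (suc n) ≡ (f ⋆ g) n
tMul-⋆ f g n = trans (sumUpTo≡∑ (suc n) _) (sym (sumUpTo≡∑ n _))

⋆-tMul : ∀ (f g : Series) n → (f ⋆ tMul g) (suc n) ≡ (f ⋆ g) n
⋆-tMul f g n = begin
  (f ⋆ tMul g) (suc n) ≡⟨ ⋆-comm f (tMul g) (suc n) ⟩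
  (tMul g ⋆ f) (suc n) ≡⟨ tMul-⋆ g f n ⟩
  (g ⋆ f) n            ≡⟨ ⋆-comm g f n ⟩
  (f ⋆ g) n            ∎

⋆-distribˡ-sumSeries : ∀ (f : Series) N (G : ℕ → Series) → f ⋆ sumSeries N G ≗ sumSeries N (λ m → f ⋆ G m)
⋆-distribˡ-sumSeries f N G n = begin
  (f ⋆ sumSeries N G) n
    ≡⟨ sumUpTo≡∑ n _ ⟩
  ∑[ k ≤ n ] (f (toℕ k) * sumUpTo N (λ m → G m (n ∸ toℕ k)))
    ≡⟨ sum-cong-≗ {suc n} (λ k → cong (f (toℕ k) *_) (sumUpTo≡∑ N (λ m → G m (n ∸ toℕ k)))) ⟩
  ∑[ k ≤ n ] (f (toℕ k) * ∑[ m ≤ N ] G (toℕ m) (n ∸ toℕ k))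
    ≡⟨ sum-cong-≗ {suc n} (λ k → *-distribˡ-sum {suc N} (f (toℕ k)) (λ m → G (toℕ m) (n ∸ toℕ k))) ⟩
  ∑[ k ≤ n ] ∑[ m ≤ N ] (f (toℕ k) * G (toℕ m) (n ∸ toℕ k))
    ≡⟨ ∑-comm {suc n} {suc N} (λ k m → f (toℕ k) * G (toℕ m) (n ∸ toℕ k)) ⟩
  ∑[ m ≤ N ] ∑[ k ≤ n ] (f (toℕ k) * G (toℕ m) (n ∸ toℕ k))
    ≡⟨ sum-cong-≗ {suc N} (λ m → sumUpTo≡∑ n (λ k → f k * G (toℕ m) (n ∸ k))) ⟨
  ∑[ m ≤ N ] (f ⋆ G (toℕ m)) n
    ≡⟨ sumUpTo≡∑ N (λ m → (f ⋆ G m) n) ⟨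
  sumSeries N (λ m → f ⋆ G m) n
    ∎

viaDown : ∀ {ℓ} → (Fin ℓ → ℕ) → (ℕ → ℕ) → ℕ → ℕ
viaDown {ℓ} β F h = ΣFin ℓ (λ i → β i * F (h + toℕ i)) + F (h + ℓ)

Motzkin-suc-suc : ∀ ℓ (α β : Fin ℓ → ℕ) n h →
                  Motzkin ℓ α β (suc n) (suc h) ≡ Motzkin ℓ α β n h + viaDown β (Motzkin ℓ α β n) (suc h)
Motzkin-suc-suc ℓ α β n h = +-assoc (Motzkin ℓ α β n h) _ _

viaDown-cong : ∀ {ℓ} (β : Fin ℓ → ℕ) {F G : ℕ → ℕ} → F ≗ G → viaDown β F ≗ viaDown β G
viaDown-cong {ℓ} β F≗G h = cong₂ _+_ (ΣFin-cong ℓ (λ i → cong (β i *_) (F≗G (h + toℕ i)))) (F≗G (h + ℓ))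

viaDown-shift : ∀ {ℓ} (β : Fin ℓ → ℕ) (F : ℕ → ℕ) c h → viaDown β F (c + h) ≡ viaDown β (F ∘ (c +_)) h
viaDown-shift {ℓ} β F c h =
  cong₂ _+_ (ΣFin-cong ℓ (λ i → cong (λ x → β i * F x) (+-assoc c h (toℕ i)))) (cong F (+-assoc c h ℓ))

viaDown-linear : ∀ {ℓ} (β : Fin ℓ → ℕ) {n} (F : Fin n → ℕ → ℕ) (a : Fin n → ℕ) h →
                 ∑[ k < n ] (viaDown β (F k) h * a k) ≡ viaDown β (λ h' → ∑[ k < n ] (F k h' * a k)) h
viaDown-linear {ℓ} β {n} F a h = begin
  ∑[ k < n ] (viaDown β (F k) h * a k)
    ≡⟨ sum-cong-≗ {n} (λ k → *-distribʳ-+ (a k) (ΣFin ℓ (λ i → β i * F k (h + toℕ i))) _) ⟩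
  ∑[ k < n ] (ΣFin ℓ (λ i → β i * F k (h + toℕ i)) * a k + F k (h + ℓ) * a k)
    ≡⟨ ∑-distrib-+ {n} (λ k → ΣFin ℓ (λ i → β i * F k (h + toℕ i)) * a k) _ ⟩
  ∑[ k < n ] (ΣFin ℓ (λ i → β i * F k (h + toℕ i)) * a k) + ∑[ k < n ] (F k (h + ℓ) * a k)
    ≡⟨ cong (_+ ∑[ k < n ] (F k (h + ℓ) * a k)) weighted ⟩
  viaDown β (λ h' → ∑[ k < n ] (F k h' * a k)) h
    ∎
  where
    weighted : ∑[ k < n ] (ΣFin ℓ (λ i → β i * F k (h + toℕ i)) * a k)
             ≡ ΣFin ℓ (λ i → β i * ∑[ k < n ] (F k (h + toℕ i) * a k))
    weighted = begin
      ∑[ k < n ] (ΣFin ℓ (λ i → β i * F k (h + toℕ i)) * a k)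
        ≡⟨ sum-cong-≗ {n} (λ k → cong (_* a k) (ΣFin≡∑ ℓ _)) ⟩
      ∑[ k < n ] (∑[ i < ℓ ] (β i * F k (h + toℕ i)) * a k)
        ≡⟨ sum-cong-≗ {n} (λ k → *-distribʳ-sum {ℓ} (a k) (λ i → β i * F k (h + toℕ i))) ⟩
      ∑[ k < n ] ∑[ i < ℓ ] (β i * F k (h + toℕ i) * a k)
        ≡⟨ sum-cong-≗ {n} (λ k → sum-cong-≗ {ℓ} (λ i → *-assoc (β i) (F k (h + toℕ i)) (a k))) ⟩
      ∑[ k < n ] ∑[ i < ℓ ] (β i * (F k (h + toℕ i) * a k))
        ≡⟨ ∑-comm {n} {ℓ} (λ k i → β i * (F k (h + toℕ i) * a k)) ⟩
      ∑[ i < ℓ ] ∑[ k < n ] (β i * (F k (h + toℕ i) * a k))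
        ≡⟨ sum-cong-≗ {ℓ} (λ i → *-distribˡ-sum {n} (β i) (λ k → F k (h + toℕ i) * a k)) ⟨
      ∑[ i < ℓ ] (β i * ∑[ k < n ] (F k (h + toℕ i) * a k))
        ≡⟨ ΣFin≡∑ ℓ _ ⟨
      ΣFin ℓ (λ i → β i * ∑[ k < n ] (F k (h + toℕ i) * a k))
        ∎

viaDown-vanishing : ∀ {ℓ} (β : Fin ℓ → ℕ) {F : ℕ → ℕ} {h} → (∀ h' → h ≤ h' → F h' ≡ 0) → viaDown β F h ≡ 0
viaDown-vanishing {ℓ} β {F} {h} F≡0 = cong₂ _+_ colored (F≡0 (h + ℓ) (m≤m+n h ℓ))
  where
    colored : ΣFin ℓ (λ i → β i * F (h + toℕ i)) ≡ 0
    colored = begin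
      ΣFin ℓ (λ i → β i * F (h + toℕ i))
        ≡⟨ ΣFin-cong ℓ (λ i → cong (β i *_) (F≡0 (h + toℕ i) (m≤m+n h (toℕ i)))) ⟩
      ΣFin ℓ (λ i → β i * 0)             ≡⟨ ΣFin-cong ℓ (λ i → *-zeroʳ (β i)) ⟩
      ΣFin ℓ (λ _ → 0)                   ≡⟨ ΣFin≡∑ ℓ _ ⟩
      ∑[ i < ℓ ] 0                       ≡⟨ sum-replicate-zero ℓ ⟩
      0                                  ∎

Motzkin-unreachable : ∀ ℓ (α β : Fin ℓ → ℕ) {n h} → n < h → Motzkin ℓ α β n h ≡ 0
Motzkin-unreachable ℓ α β {zero}  {suc h} _         = refl
Motzkin-unreachable ℓ α β {suc n} {suc h} (s≤s n<h) = begin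
  Motzkin ℓ α β (suc n) (suc h)
    ≡⟨ Motzkin-suc-suc ℓ α β n h ⟩
  Motzkin ℓ α β n h + viaDown β (Motzkin ℓ α β n) (suc h)
    ≡⟨ cong₂ _+_ (Motzkin-unreachable ℓ α β n<h) above ⟩
  0
    ∎
  where
    above : viaDown β (Motzkin ℓ α β n) (suc h) ≡ 0
    above = viaDown-vanishing β
              (λ h' h<h' → Motzkin-unreachable ℓ α β (≤-trans n<h (≤-trans (n≤1+n h) h<h')))

module LastVisit {ℓ : ℕ} (α β : Fin ℓ → ℕ) (m : ℕ) where

  private
    A B : ℕ → ℕ → ℕ
    A = Motzkin ℓ α β
    B = Motzkin ℓ β β

  -- k is the length of the part after the last visit to height m.
  glued : ℕ → ℕ → ℕ
  glued h n = ∑[ k < n ] (B (toℕ k) h * A (n ∸ suc (toℕ k)) m)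

  Motzkin≡glued : ∀ n h → A n (suc (m + h)) ≡ glued h n
  Motzkin≡glued zero    h = refl
  Motzkin≡glued (suc n) h = begin
    A (suc n) (suc (m + h))
      ≡⟨ Motzkin-suc-suc ℓ α β n (m + h) ⟩
    A n (m + h) + viaDown β (A n) (suc m + h)
      ≡⟨ cong (A n (m + h) +_) down ⟩
    A n (m + h) + ∑[ k < n ] (viaDown β (B (toℕ k)) h * a k)
      ≡⟨ lowest h ⟩
    glued h (suc n)
      ∎
    where
      a : Fin n → ℕ
      a k = A (n ∸ suc (toℕ k)) m

      down : viaDown β (A n) (suc m + h) ≡ ∑[ k < n ] (viaDown β (B (toℕ k)) h * a k)
      down = begin
        viaDown β (A n) (suc m + h)               ≡⟨ viaDown-shift β (A n) (suc m) h ⟩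
        viaDown β (λ h' → A n (suc (m + h'))) h   ≡⟨ viaDown-cong β (Motzkin≡glued n) h ⟩
        viaDown β (λ h' → glued h' n) h           ≡⟨ viaDown-linear β (B ∘ toℕ) a h ⟨
        ∑[ k < n ] (viaDown β (B (toℕ k)) h * a k) ∎

      lowest : ∀ h → A n (m + h) + ∑[ k < n ] (viaDown β (B (toℕ k)) h * a k) ≡ glued h (suc n)
      -- B (suc k) 0 unfolds to viaDown β (B k) 0, because B uses the colours β at height 0 too.
      lowest zero    = cong (_+ ∑[ k < n ] (viaDown β (B (toℕ k)) 0 * a k))
                            (trans (cong (A n) (+-identityʳ m)) (sym (*-identityˡ (A n m))))
      lowest (suc h) = begin
        A n (m + suc h) + ∑[ k < n ] (viaDown β (B (toℕ k)) (suc h) * a k)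
          ≡⟨ cong (_+ ∑[ k < n ] (viaDown β (B (toℕ k)) (suc h) * a k))
                  (trans (cong (A n) (+-suc m h)) (Motzkin≡glued n h)) ⟩
        ∑[ k < n ] (B (toℕ k) h * a k) + ∑[ k < n ] (viaDown β (B (toℕ k)) (suc h) * a k)
          ≡⟨ ∑-distrib-+ {n} (λ k → B (toℕ k) h * a k) _ ⟨
        ∑[ k < n ] (B (toℕ k) h * a k + viaDown β (B (toℕ k)) (suc h) * a k)
          ≡⟨ sum-cong-≗ {n} (λ k → *-distribʳ-+ (a k) (B (toℕ k) h) _) ⟨
        ∑[ k < n ] ((B (toℕ k) h + viaDown β (B (toℕ k)) (suc h)) * a k)
          ≡⟨ sum-cong-≗ {n} (λ k → cong (_* a k) (Motzkin-suc-suc ℓ β β (toℕ k) h)) ⟨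
        glued (suc h) (suc n)
          ∎

Mgf-glue : ∀ ℓ (α β : Fin ℓ → ℕ) m h → Mgf ℓ α β (suc (m + h)) ≗ tMul (Mgf ℓ β β h) ⋆ Mgf ℓ α β m
-- The k = 0 term of the product vanishes, as tMul _ 0 = 0; the rest is glued h n.
Mgf-glue ℓ α β m h n = trans (LastVisit.Motzkin≡glued α β m n h) (sym (sumUpTo≡∑ n _))

Mgf-suc : ∀ ℓ (α β : Fin ℓ → ℕ) m → Mgf ℓ α β (suc m) ≗ tMul (Mgf ℓ β β 0) ⋆ Mgf ℓ α β m
Mgf-suc ℓ α β m n = trans (cong (Motzkin ℓ α β n ∘ suc) (sym (+-identityʳ m))) (Mgf-glue ℓ α β m 0 n)

tMul-Mgf≡pow : ∀ ℓ (β : Fin ℓ → ℕ) h → tMul (Mgf ℓ β β h) ≗ pow (tMul (Mgf ℓ β β 0)) (suc h)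
tMul-Mgf≡pow ℓ β zero    n       = sym (⋆-identityʳ (tMul (Mgf ℓ β β 0)) n)
tMul-Mgf≡pow ℓ β (suc h) zero    = refl
tMul-Mgf≡pow ℓ β (suc h) (suc n) = begin
  Motzkin ℓ β β n (suc h)          ≡⟨ Mgf-suc ℓ β β h n ⟩
  (T ⋆ Mgf ℓ β β h) n              ≡⟨ ⋆-tMul T (Mgf ℓ β β h) n ⟨
  (T ⋆ tMul (Mgf ℓ β β h)) (suc n) ≡⟨ ⋆-congʳ-≤ T (suc n) (λ k _ → tMul-Mgf≡pow ℓ β h k) ⟩
  (T ⋆ pow T (suc h)) (suc n)      ∎
  where
    T : Series
    T = tMul (Mgf ℓ β β 0)

Mgf≡Mgf₀⋆pow : ∀ ℓ (α β : Fin ℓ → ℕ) p → Mgf ℓ α β p ≗ Mgf ℓ α β 0 ⋆ pow (tMul (Mgf ℓ β β 0)) p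
Mgf≡Mgf₀⋆pow ℓ α β zero    n = sym (⋆-identityʳ (Mgf ℓ α β 0) n)
Mgf≡Mgf₀⋆pow ℓ α β (suc h) n = begin
  Mgf ℓ α β (suc h) n                         ≡⟨ Mgf-glue ℓ α β 0 h n ⟩
  (tMul (Mgf ℓ β β h) ⋆ Mgf ℓ α β 0) n        ≡⟨ ⋆-congˡ (Mgf ℓ α β 0) (tMul-Mgf≡pow ℓ β h) n ⟩
  (pow T (suc h) ⋆ Mgf ℓ α β 0) n             ≡⟨ ⋆-comm (pow T (suc h)) (Mgf ℓ α β 0) n ⟩
  (Mgf ℓ α β 0 ⋆ pow T (suc h)) n             ∎
  where
    T : Series
    T = tMul (Mgf ℓ β β 0)

pow-vanishes-below : ∀ ℓ (β : Fin ℓ → ℕ) {p k} → k < p → pow (tMul (Mgf ℓ β β 0)) p k ≡ 0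
pow-vanishes-below ℓ β {suc h} {zero}  _         = sym (tMul-Mgf≡pow ℓ β h 0)
pow-vanishes-below ℓ β {suc h} {suc k} (s≤s k<h) =
  trans (sym (tMul-Mgf≡pow ℓ β h (suc k))) (Motzkin-unreachable ℓ β β k<h)

sumSeries-pow-stable : ∀ ℓ (β : Fin ℓ → ℕ) {k} K → k ≤ K →
                       sumSeries K (pow (tMul (Mgf ℓ β β 0))) k ≡ sumSeries k (pow (tMul (Mgf ℓ β β 0))) k
sumSeries-pow-stable ℓ β {k} K =
  sumUpTo-vanishing-tail (λ p → pow (tMul (Mgf ℓ β β 0)) p k) (λ p k<p → pow-vanishes-below ℓ β k<p)

sumSeries-Mgf-recursion : ∀ ℓ (α β : Fin ℓ → ℕ) n N → n ≤ N →
  sumSeries N (Mgf ℓ α β) n ≡ (Mgf ℓ α β 0 ⊕ (tMul (Mgf ℓ β β 0) ⋆ sumSeries N (Mgf ℓ α β))) n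
sumSeries-Mgf-recursion ℓ α β n N n≤N = begin
  sumSeries N A n                         ≡⟨ sumUpTo-vanishing-tail (λ m → A m n) unreachable (n≤1+n N) ⟨
  sumSeries (suc N) A n                   ≡⟨ sumUpTo-peel N (λ m → A m n) ⟩
  A 0 n + sumSeries N (A ∘ suc) n         ≡⟨ cong (A 0 n +_) (sumUpTo-cong N (λ m → Mgf-suc ℓ α β m n)) ⟩
  A 0 n + sumSeries N (λ m → T ⋆ A m) n   ≡⟨ cong (A 0 n +_) (⋆-distribˡ-sumSeries T N A n) ⟨
  (A 0 ⊕ (T ⋆ sumSeries N A)) n           ∎
  where
    A : ℕ → Series
    A = Mgf ℓ α β
    T : Series
    T = tMul (Mgf ℓ β β 0)
    unreachable : ∀ p → N < p → A p n ≡ 0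
    unreachable p N<p = Motzkin-unreachable ℓ α β (≤-<-trans n≤N N<p)

sumSeries-Mgf-geometric : ∀ ℓ (α β : Fin ℓ → ℕ) n N K → n ≤ N → n ≤ K →
  sumSeries N (Mgf ℓ α β) n ≡ (Mgf ℓ α β 0 ⋆ sumSeries K (pow (tMul (Mgf ℓ β β 0)))) n
sumSeries-Mgf-geometric ℓ α β n N K n≤N n≤K = begin
  sumSeries N A n                         ≡⟨ sumUpTo-cong N (λ p → Mgf≡Mgf₀⋆pow ℓ α β p n) ⟩
  sumSeries N (λ p → A 0 ⋆ pow T p) n     ≡⟨ ⋆-distribˡ-sumSeries (A 0) N (pow T) n ⟨
  (A 0 ⋆ sumSeries N (pow T)) n           ≡⟨ ⋆-congʳ-≤ (A 0) n N≈K ⟩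
  (A 0 ⋆ sumSeries K (pow T)) n           ∎
  where
    A : ℕ → Series
    A = Mgf ℓ α β
    T : Series
    T = tMul (Mgf ℓ β β 0)
    N≈K : ∀ k → k ≤ n → sumSeries N (pow T) k ≡ sumSeries K (pow T) k
    N≈K k k≤n = trans (sumSeries-pow-stable ℓ β N (≤-trans k≤n n≤N))
                      (sym (sumSeries-pow-stable ℓ β K (≤-trans k≤n n≤K)))

corollary2p4 : (ℓ : ℕ) → 1 ≤ ℓ → (α β : Fin ℓ → ℕ) →
    -- (1) Σ_m M_m(α,β,t) · (1 - t M_0(β,β,t)) = M_0(α,β,t), written without
    --     subtraction as  S = M_0(α,β,t) + t M_0(β,β,t) S  at coefficient n,
    --     where S is the partial sum Σ_{m ≤ N} M_m(α,β,t), N ≥ n.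
    ((n N : ℕ) → n ≤ N →
      sumSeries N (Mgf ℓ α β) n
        ≡ (Mgf ℓ α β 0 ⊕ (tMul (Mgf ℓ β β 0) ⋆ sumSeries N (Mgf ℓ α β))) n)
    ×
    -- (2) Σ_m M_m(α,β,t) = M_0(α,β,t) Σ_k (t M_0(β,β,t))^k, coefficientwise:
    --     the coefficient of t^n in the partial sums stabilises for N, K ≥ n.
    ((n N K : ℕ) → n ≤ N → n ≤ K →
      sumSeries N (Mgf ℓ α β) n
        ≡ (Mgf ℓ α β 0 ⋆ sumSeries K (pow (tMul (Mgf ℓ β β 0)))) n)
corollary2p4 ℓ _ α β = sumSeries-Mgf-recursion ℓ α β , sumSeries-Mgf-geometric ℓ α β
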